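{- Let $t \geq s \geq 1$ be integers and let $G=C_3^tC_4^s$. Then $G$ is graceful when $t\equiv 0,1\pmod 4$ and near graceful when $t\equiv 2,3\pmod 4$.
   Context: $C_n^t$ denotes the union of $t$ cycles of length $n$ sharing exactly one common (central) vertex, and $C_3^tC_4^s$ denotes the graph obtained by identifying the central vertices of $C_3^t$ and $C_4^s$ (a windmill with $t$ triangle vanes and $s$ $4$-cycle vanes). For a graph $G$ with $m$ edges, a graceful labelling is an injective map $f:V(G)\to\{0,\ldots,m\}$ such that $g(uv)=|f(u)-f(v)|$ is a bijection $E(G)\to\{1,\ldots,m\}$. A near graceful labelling is an injective map $f:V(G)\to\{0,\ldots,m+1\}$ such that $g(uv)=|f(u)-f(v)|$ is a bijection onto $\{1,\ldots,m-1,m\}$ or onto $\{1,\ldots,m-1,m+1\}$. A graph is (near) graceful if it admits such a labelling. -}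

module Defs where

open import Data.Nat using (ℕ; suc; _+_; _*_; _∸_; _≤_; ∣_-_∣)
open import Data.Fin using (Fin)
open import Data.Fin.Base using () renaming (zero to fz; suc to fs)
open import Data.List using (List; []; _∷_; _++_; map; upTo; concatMap; allFin; length)
open import Data.List.Relation.Binary.Permutation.Propositional using (_↭_)
open import Data.Product using (_×_; _,_; Σ)
open import Data.Sum using (_⊎_)
open import Function.Definitions using (Injective)
open import Relation.Binary.PropositionalEquality using (_≡_)

-- A finite graph given by a vertex type and its list of edges (each edge listed once).
record Graph : Set₁ where
  field
    Vert  : Set
    edges : List (Vert × Vert)

open Graph public

size : Graph → ℕ
size G = length (edges G)

edgeLabels : (G : Graph) → (Vert G → ℕ) → List ℕ
edgeLabels G f = map (λ e → ∣ f (Data.Product.proj₁ e) - f (Data.Product.proj₂ e) ∣) (edges G)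

oneTo : ℕ → List ℕ
oneTo k = map suc (upTo k)

IsGracefulLabelling : (G : Graph) → (Vert G → ℕ) → Set
IsGracefulLabelling G f =
  Injective _≡_ _≡_ f × (∀ v → f v ≤ size G) × (edgeLabels G f ↭ oneTo (size G))

Graceful : Graph → Set
Graceful G = Σ (Vert G → ℕ) (IsGracefulLabelling G)

IsNearGracefulLabelling : (G : Graph) → (Vert G → ℕ) → Set
IsNearGracefulLabelling G f =
  Injective _≡_ _≡_ f × (∀ v → f v ≤ suc (size G)) ×
  ((edgeLabels G f ↭ (oneTo (size G ∸ 1) ++ (size G ∷ [])))
   ⊎ (edgeLabels G f ↭ (oneTo (size G ∸ 1) ++ (suc (size G) ∷ []))))

NearGraceful : Graph → Set
NearGraceful G = Σ (Vert G → ℕ) (IsNearGracefulLabelling G)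

-- Vertices of C_3^t C_4^s: the centre, two further vertices on each triangle,
-- three further vertices on each 4-cycle.
data WVert (t s : ℕ) : Set where
  centre : WVert t s
  tri    : Fin t → Fin 2 → WVert t s
  sq     : Fin s → Fin 3 → WVert t s

triEdges : ∀ {t s} → Fin t → List (WVert t s × WVert t s)
triEdges i = (centre , tri i fz) ∷ (tri i fz , tri i (fs fz)) ∷ (tri i (fs fz) , centre) ∷ []

sqEdges : ∀ {t s} → Fin s → List (WVert t s × WVert t s)
sqEdges j = (centre , sq j fz) ∷ (sq j fz , sq j (fs fz))
          ∷ (sq j (fs fz) , sq j (fs (fs fz))) ∷ (sq j (fs (fs fz)) , centre) ∷ []

C3C4 : ℕ → ℕ → Graph
C3C4 t s = record
  { Vert  = WVert t s
  ; edges = concatMap triEdges (allFin t) ++ concatMap sqEdges (allFin s) }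

-- Label the centre 0 and let O = t + 4s.  A Skolem system of order t is a set of t
-- pairs {p, p + d}, one for each difference d = 1 … t, whose 2t positions are exactly 1 … 2t
-- (hooked: 1 … 2t − 1 and 2t + 1).  Giving the two outer vertices of a triangle the labels O + p
-- and O + p + d produces the edge labels d, O + p, O + p + d, so the triangles use 1 … t and
-- O + 1 … O + 2t.  A two-fold Skolem system of order s has two pairs {p, p + d}, {q, q + d} for
-- each d = 1 … s with positions exactly 1 … 4s; labelling a square d + t + p, d, d + t + q
-- produces the edge labels t + p, t + p + d, t + q, t + q + d, which fill t + 1 … t + 4s.  A
-- neighbour of the centre carries the label of its edge to the centre, and the middle vertices
-- of the squares carry the distinct labels d ≤ s ≤ t below all others, so the labelling is
-- injective.  Skolem systems exist for t ≡ 0, 1 (mod 4), hooked ones for t ≡ 2, 3 and two-fold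
-- ones for every s; each is given by a few families of pairs whose data are linear in a
-- parameter k, checked once and for all by a computation on the coefficients.

module Submission where

open import Data.Empty using (⊥-elim)
open import Data.Fin using (Fin)
open import Data.Fin.Patterns using (0F; 1F; 2F)
open import Data.List
  using (List; []; _∷_; _++_; [_]; map; length; applyUpTo; foldr; concatMap; lookup; allFin)
open import Data.List.Properties
  using (++-assoc; ++-identityʳ; map-∘; map-tabulate; tabulate-lookup; concatMap-map; map-concatMap;
         concatMap-cong; map-upTo; length-++; map-++; concatMap-++; length-map)
open import Data.List.Membership.Propositional using (_∈_)
open import Data.List.Membership.Propositional.Properties
  using (∈-++⁻; ∈-++⁺ˡ; ∈-++⁺ʳ; ∈-map⁺; ∈-lookup; ∈-allFin; ∈-concat⁺′)
open import Data.List.Relation.Unary.Any using (here; there)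
import Data.List.Relation.Unary.All as All
import Data.List.Relation.Unary.All.Properties as All
open import Data.List.Relation.Unary.AllPairs using ([]; _∷_)
open import Data.List.Relation.Unary.Unique.Propositional using (Unique)
open import Data.List.Relation.Unary.Unique.Propositional.Properties using () renaming (++⁺ to ++⁺ᵘ)
open import Data.List.Relation.Binary.Permutation.Propositional
  using (_↭_; refl; prep; swap; trans; ↭-refl; ↭-sym; ↭-trans; ↭-reflexive; ↭⇒↭ₛ;
         module PermutationReasoning)
open import Data.List.Relation.Binary.Permutation.Propositional.Properties
  using (++-comm; ∷↭∷ʳ; ↭-length; ++⁺ˡ; ++⁺ʳ; ++⁺; shifts; map⁺; ∈-resp-↭)
open import Data.Maybe using (Maybe; just; nothing)
import Data.Maybe as Maybe
open import Data.Nat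
  using (ℕ; zero; suc; _+_; _*_; _∸_; _≤_; _<_; z≤n; s≤s; _≟_; _%_; _/_; NonZero; ∣_-_∣)
open import Data.Nat.DivMod using (m≡m%n+[m/n]*n; m%n<n)
open import Data.Nat.Properties
  using (+-identityʳ; +-suc; *-zeroʳ; +-comm; *-identityʳ; ≤-refl; ≤-trans; ≤-reflexive; ≤-pred; ≤-<-trans;
         n≤1+n; m≤m+n; m<m+n; +-monoˡ-≤; <⇒≢; <-irrefl; m∸n≤m;
         ∣m+n-m+o∣≡∣n-o∣; ∣m-m+n∣≡n; ∣-∣-identityʳ; ∣-∣-comm)
open import Data.Nat.Tactic.RingSolver using (solve-∀)
open import Data.Product using (_×_; _,_; proj₁; proj₂; Σ-syntax; ∃; -,_)
open import Data.Product.Properties using (≡-dec)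
open import Data.Sum using (_⊎_; inj₁; inj₂)
open import Function using (_∘_; id)
open import Function.Definitions using (Injective)
open import Relation.Binary.Definitions using (DecidableEquality)
open import Relation.Binary.PropositionalEquality
  using (_≡_; refl; sym; cong; cong₂; subst; setoid; module ≡-Reasoning)
  renaming (trans to ≡-trans)
open import Relation.Nullary using (yes; no)
import Data.List.Relation.Binary.Permutation.Setoid.Properties (setoid ℕ) as Setoid

open import Defs

Unique[map]⇒injective : ∀ {A : Set} (f : A → ℕ) {xs x y} →
  Unique (map f xs) → x ∈ xs → y ∈ xs → f x ≡ f y → x ≡ y
Unique[map]⇒injective f {_ ∷ xs} (_ ∷ u) (here refl) (here refl) _ = refl
Unique[map]⇒injective f {_ ∷ xs} (fx∉ ∷ u) (here refl) (there y∈) fx≡fy =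
  ⊥-elim (All.lookup (All.map⁻ fx∉) y∈ fx≡fy)
Unique[map]⇒injective f {_ ∷ xs} (fy∉ ∷ u) (there x∈) (here refl) fx≡fy =
  ⊥-elim (All.lookup (All.map⁻ fy∉) x∈ (sym fx≡fy))
Unique[map]⇒injective f {_ ∷ xs} (_ ∷ u) (there x∈) (there y∈) fx≡fy =
  Unique[map]⇒injective f u x∈ y∈ fx≡fy

Unique-resp-↭ : ∀ {xs ys : List ℕ} → xs ↭ ys → Unique ys → Unique xs
Unique-resp-↭ p = Setoid.Unique-resp-↭ (↭⇒↭ₛ (↭-sym p))

map-lookup-allFin : ∀ {A : Set} (xs : List A) → map (lookup xs) (allFin (length xs)) ≡ xs
map-lookup-allFin xs = ≡-trans (map-tabulate id (lookup xs)) (tabulate-lookup xs)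

concatMap-lookup : ∀ {A B : Set} (f : A → List B) xs →
  concatMap (f ∘ lookup xs) (allFin (length xs)) ≡ concatMap f xs
concatMap-lookup f xs =
  ≡-trans (sym (concatMap-map f (lookup xs) (allFin (length xs)))) (cong (concatMap f) (map-lookup-allFin xs))

-- Arithmetic progressions

progression : (step first count : ℕ) → List ℕ
progression c a zero    = []
progression c a (suc n) = a ∷ progression c (c + a) n

range : ℕ → ℕ → List ℕ
range = progression 1

length-progression : ∀ c a n → length (progression c a n) ≡ n
length-progression c a zero    = refl
length-progression c a (suc n) = cong suc (length-progression c (c + a) n)

progression-++ : ∀ c a m n → progression c a m ++ progression c (a + m * c) n ≡ progression c a (m + n)
progression-++ c a zero    n = cong (λ x → progression c x n) (+-identityʳ a)
progression-++ c a (suc m) n =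
  cong (a ∷_) (≡-trans (cong (λ x → progression c (c + a) m ++ progression c x n) (shift c a m))
                       (progression-++ c (c + a) m n))
  where
  shift : ∀ c a m → a + (c + m * c) ≡ c + a + m * c
  shift = solve-∀

progression-∷ʳ : ∀ c a n → progression c a (suc n) ≡ progression c a n ++ [ a + n * c ]
progression-∷ʳ c a n = ≡-trans (cong (progression c a) (+-comm 1 n)) (sym (progression-++ c a n 1))

range-++ : ∀ a m n → range a m ++ range (a + m) n ≡ range a (m + n)
range-++ a m n = ≡-trans (cong (λ x → range a m ++ range (a + x) n) (sym (*-identityʳ m))) (progression-++ 1 a m n)

map-+-progression : ∀ k c a n → map (k +_) (progression c a n) ≡ progression c (k + a) n
map-+-progression k c a zero    = refl
map-+-progression k c a (suc n) =
  cong (k + a ∷_) (≡-trans (map-+-progression k c (c + a) n) (cong (λ x → progression c x n) (reassoc k c a)))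
  where
  reassoc : ∀ k c a → k + (c + a) ≡ c + (k + a)
  reassoc = solve-∀

∈-range⁻ : ∀ {x} a n → x ∈ range a n → a ≤ x × x < a + n
∈-range⁻ a (suc n) (here refl) = ≤-refl , ≤-trans (s≤s (m≤m+n a n)) (≤-reflexive (sym (+-suc a n)))
∈-range⁻ a (suc n) (there x∈) with ∈-range⁻ (suc a) n x∈
... | a<x , x<a+n = ≤-trans (n≤1+n a) a<x , ≤-trans x<a+n (≤-reflexive (sym (+-suc a n)))

range-unique : ∀ a n → Unique (range a n)
range-unique a zero    = []
range-unique a (suc n) =
  All.tabulate (λ x∈ → <⇒≢ (proj₁ (∈-range⁻ (suc a) n x∈))) ∷ range-unique (suc a) n

oneTo≡range : ∀ n → oneTo n ≡ range 1 n
oneTo≡range n = ≡-trans (map-upTo suc n) (applyUpTo-range suc 1 n λ _ → refl)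
  where
  applyUpTo-range : ∀ f a n → (∀ i → f i ≡ a + i) → applyUpTo f n ≡ range a n
  applyUpTo-range f a zero    f≗ = refl
  applyUpTo-range f a (suc n) f≗ = cong₂ _∷_ (≡-trans (f≗ 0) (+-identityʳ a))
    (applyUpTo-range (λ i → f (suc i)) (suc a) n λ i → ≡-trans (f≗ (suc i)) (+-suc a i))

↭-range-length : ∀ {xs c a m} → xs ↭ progression c a m → xs ↭ progression c a (length xs)
↭-range-length {c = c} {a} {m} p =
  ↭-trans p (↭-reflexive (cong (progression c a) (≡-trans (sym (length-progression c a m)) (sym (↭-length p)))))

mutual
  interleave-even : ∀ a n → progression 2 a n ++ progression 2 (suc a) n ↭ range a (n + n)
  interleave-even a zero    = ↭-refl
  interleave-even a (suc n) = begin
    a ∷ (progression 2 (2 + a) n ++ progression 2 (suc a) (suc n))  ↭⟨ prep a (++-comm (progression 2 (2 + a) n) _) ⟩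
    a ∷ (progression 2 (suc a) (suc n) ++ progression 2 (2 + a) n)  ↭⟨ prep a (interleave-odd (suc a) n) ⟩
    range a (2 + (n + n))                                            ≡⟨ cong (λ m → range a (suc m)) (sym (+-suc n n)) ⟩
    range a (suc n + suc n)                                          ∎
    where open PermutationReasoning

  interleave-odd : ∀ a n → progression 2 a (suc n) ++ progression 2 (suc a) n ↭ range a (suc n + n)
  interleave-odd a n =
    prep a (↭-trans (++-comm (progression 2 (2 + a) n) (progression 2 (suc a) n)) (interleave-even (suc a) n))

interleave : ∀ a {m n} → m ≡ n ⊎ m ≡ suc n → progression 2 a m ++ progression 2 (suc a) n ↭ range a (m + n)
interleave a {n = n} (inj₁ refl) = interleave-even a n
interleave a {n = n} (inj₂ refl) = interleave-odd a n

↭-hooked-length : ∀ {xs L} → xs ↭ range 1 L ++ [ 2 + L ] → xs ↭ range 1 (length xs ∸ 1) ++ [ suc (length xs) ]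
↭-hooked-length {xs} {L} p rewrite ↭-length p | length-++ (range 1 L) {[ 2 + L ]}
                                 | length-progression 1 1 L | +-comm L 1 = p

range-++-map-+ : ∀ m n → range 1 m ++ map (m +_) (range 1 n) ≡ range 1 (m + n)
range-++-map-+ m n =
  ≡-trans (cong (λ xs → range 1 m ++ xs) (map-+-progression m 1 1 n))
          (≡-trans (cong (λ a → range 1 m ++ range a n) (+-comm m 1)) (range-++ 1 m n))

hook-shift : ∀ o {t} → 1 ≤ t → o + suc (t + t) ≡ 2 + (o + (t + t ∸ 1))
hook-shift o {suc u} _ = shift o u
  where
  shift : ∀ o u → o + suc (suc u + suc u) ≡ 2 + (o + (u + suc u))
  shift = solve-∀

oneTo-unique : ∀ n → Unique (oneTo n)
oneTo-unique n = subst Unique (sym (oneTo≡range n)) (range-unique 1 n)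

∈-oneTo⁻ : ∀ {x} n → x ∈ oneTo n → x ≤ n
∈-oneTo⁻ n x∈ = ≤-pred (proj₂ (∈-range⁻ 1 n (subst (_ ∈_) (oneTo≡range n) x∈)))

∈-hooked⁻ : ∀ {x} n → x ∈ oneTo (n ∸ 1) ++ [ suc n ] → x ≤ suc n
∈-hooked⁻ n x∈ with ∈-++⁻ (oneTo (n ∸ 1)) x∈
... | inj₁ x∈oneTo    = ≤-trans (∈-oneTo⁻ (n ∸ 1) x∈oneTo) (≤-trans (m∸n≤m n 1) (n≤1+n n))
... | inj₂ (here refl) = ≤-refl

hooked-unique : ∀ n → Unique (oneTo (n ∸ 1) ++ [ suc n ])
hooked-unique n = ++⁺ᵘ (oneTo-unique (n ∸ 1)) (All.[] ∷ []) λ where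
  (x∈ , here refl) → <-irrefl refl (s≤s (≤-trans (∈-oneTo⁻ (n ∸ 1) x∈) (m∸n≤m n 1)))

-- Skolem systems

-- (p , d) stands for the pair of positions p and p + d, at distance d
positions : List (ℕ × ℕ) → List ℕ
positions []            = []
positions ((p , d) ∷ T) = p ∷ p + d ∷ positions T

differences : List (ℕ × ℕ) → List ℕ
differences = map proj₂

IsSkolem : ℕ → List (ℕ × ℕ) → Set
IsSkolem n T = length T ≡ n × positions T ↭ range 1 (n + n) × differences T ↭ range 1 n

IsHookedSkolem : ℕ → List (ℕ × ℕ) → Set
IsHookedSkolem n T =
  length T ≡ n × positions T ↭ range 1 (n + n ∸ 1) ++ [ suc (n + n) ] × differences T ↭ range 1 n

-- (d , p , q) stands for the two pairs p, p + d and q, q + d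
firsts seconds : List (ℕ × ℕ × ℕ) → List (ℕ × ℕ)
firsts  = map λ (d , p , q) → p , d
seconds = map λ (d , p , q) → q , d

IsTwoFoldSkolem : ℕ → List (ℕ × ℕ × ℕ) → Set
IsTwoFoldSkolem s Q =
  length Q ≡ s × positions (firsts Q) ++ positions (seconds Q) ↭ range 1 (4 * s) × map proj₁ Q ↭ range 1 s

length-positions : ∀ T → length (positions T) ≡ length T + length T
length-positions []      = refl
length-positions (_ ∷ T) = cong suc (≡-trans (cong suc (length-positions T)) (sym (+-suc (length T) (length T))))

positions-++ : ∀ T U → positions (T ++ U) ≡ positions T ++ positions U
positions-++ []            U = refl
positions-++ ((p , d) ∷ T) U = cong (λ xs → p ∷ p + d ∷ xs) (positions-++ T U)

-- Families of pairs whose data are linear in a parameter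

-- (a , b) stands for a k + b.  Every covering condition on a family built from such forms is an
-- equality of coefficient pairs, so it is decided by evaluation, uniformly in k.
Lin : Set
Lin = ℕ × ℕ

infix 8 _k+_
_k+_ : ℕ → ℕ → Lin
a k+ b = a , b

-- Written b + k * a so that, e.g., ⟦ 4 k+ 8 ⟧ k and (2 + k) * 4 have the same normal form.
⟦_⟧ : Lin → ℕ → ℕ
⟦ a , b ⟧ k = b + k * a

infixl 6 _⊕_
_⊕_ : Lin → Lin → Lin
(a , b) ⊕ (c , d) = a + c , b + d

infixr 7 _⊛_
_⊛_ : ℕ → Lin → Lin
c ⊛ (a , b) = c * a , c * b

_≟ₗ_ : DecidableEquality Lin
_≟ₗ_ = ≡-dec _≟_ _≟_

⟦⊕⟧ : ∀ x y k → ⟦ x ⊕ y ⟧ k ≡ ⟦ x ⟧ k + ⟦ y ⟧ k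
⟦⊕⟧ (a , b) (c , d) k = distrib a b c d k
  where
  distrib : ∀ a b c d k → b + d + k * (a + c) ≡ b + k * a + (d + k * c)
  distrib = solve-∀

⟦⊛⟧ : ∀ c x k → ⟦ c ⊛ x ⟧ k ≡ ⟦ x ⟧ k * c
⟦⊛⟧ c (a , b) k = distrib a b c k
  where
  distrib : ∀ a b c k → c * b + k * (c * a) ≡ (b + k * a) * c
  distrib = solve-∀

⟦const⟧ : ∀ b k → ⟦ 0 k+ b ⟧ k ≡ b
⟦const⟧ b k = ≡-trans (cong (b +_) (*-zeroʳ k)) (+-identityʳ b)

nested : (start gap count : ℕ) → List (ℕ × ℕ)
nested u g zero    = []
nested u g (suc n) = (u , suc g + n * 2) ∷ nested (suc u) g n

length-nested : ∀ u g n → length (nested u g n) ≡ n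
length-nested u g zero    = refl
length-nested u g (suc n) = cong suc (length-nested (suc u) g n)

positions-nested : ∀ u g n → positions (nested u g n) ↭ range u n ++ range (u + n + g) n
positions-nested u g zero    = ↭-refl
positions-nested u g (suc n) = prep u (begin
  y ∷ positions (nested (suc u) g n)   ↭⟨ prep y (positions-nested (suc u) g n) ⟩
  y ∷ (inner ++ outer)                 ↭⟨ ∷↭∷ʳ y (inner ++ outer) ⟩
  (inner ++ outer) ++ [ y ]            ≡⟨ ++-assoc inner outer [ y ] ⟩
  inner ++ (outer ++ [ y ])            ≡⟨ cong (inner ++_) outer-∷ʳ ⟩
  inner ++ range (u + suc n + g) (suc n) ∎)
  where
  open PermutationReasoning
  y     = u + (suc g + n * 2)
  inner = range (suc u) n
  outer = range (suc u + n + g) n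
  shift : ∀ u n g → suc u + n + g ≡ u + suc n + g
  shift = solve-∀
  last : ∀ u n g → suc u + n + g + n * 1 ≡ u + (suc g + n * 2)
  last = solve-∀
  outer-∷ʳ : outer ++ [ y ] ≡ range (u + suc n + g) (suc n)
  outer-∷ʳ = ≡-trans (cong (λ x → outer ++ [ x ]) (sym (last u n g)))
            (≡-trans (sym (progression-∷ʳ 1 (suc u + n + g) n)) (cong (λ x → range x (suc n)) (shift u n g)))

differences-nested : ∀ u g n → differences (nested u g n) ↭ progression 2 (suc g) n
differences-nested u g zero    = ↭-refl
differences-nested u g (suc n) =
  ↭-trans (prep _ (differences-nested (suc u) g n))
    (↭-trans (∷↭∷ʳ _ _) (↭-reflexive (sym (progression-∷ʳ 2 (suc g) n))))

data Piece : Set where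
  nest : (start gap count : Lin) → Piece
  pair : (position difference : Lin) → Piece

pairsOf : ℕ → List Piece → List (ℕ × ℕ)
pairsOf k []                = []
pairsOf k (nest u g n ∷ ps) = nested (⟦ u ⟧ k) (⟦ g ⟧ k) (⟦ n ⟧ k) ++ pairsOf k ps
pairsOf k (pair p d ∷ ps)   = (⟦ p ⟧ k , ⟦ d ⟧ k) ∷ pairsOf k ps

order : List Piece → Lin
order []                = 0 k+ 0
order (nest u g n ∷ ps) = n ⊕ order ps
order (pair p d ∷ ps)   = 0 k+ 1 ⊕ order ps

length-pairsOf : ∀ k ps → length (pairsOf k ps) ≡ ⟦ order ps ⟧ k
length-pairsOf k []                = sym (⟦const⟧ 0 k)
length-pairsOf k (nest u g n ∷ ps) = begin
  length (nested (⟦ u ⟧ k) (⟦ g ⟧ k) (⟦ n ⟧ k) ++ pairsOf k ps) ≡⟨ length-++ (nested (⟦ u ⟧ k) (⟦ g ⟧ k) (⟦ n ⟧ k)) ⟩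
  length (nested (⟦ u ⟧ k) (⟦ g ⟧ k) (⟦ n ⟧ k)) + length (pairsOf k ps)
    ≡⟨ cong₂ _+_ (length-nested (⟦ u ⟧ k) (⟦ g ⟧ k) (⟦ n ⟧ k)) (length-pairsOf k ps) ⟩
  ⟦ n ⟧ k + ⟦ order ps ⟧ k ≡⟨ sym (⟦⊕⟧ n (order ps) k) ⟩
  ⟦ n ⊕ order ps ⟧ k ∎
  where open ≡-Reasoning
length-pairsOf k (pair p d ∷ ps)   =
  ≡-trans (cong suc (length-pairsOf k ps))
    (sym (≡-trans (⟦⊕⟧ (0 k+ 1) (order ps) k) (cong (_+ ⟦ order ps ⟧ k) (⟦const⟧ 1 k))))

pairsOf-++ : ∀ k ps qs → pairsOf k (ps ++ qs) ≡ pairsOf k ps ++ pairsOf k qs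
pairsOf-++ k []                qs = refl
pairsOf-++ k (nest u g n ∷ ps) qs =
  ≡-trans (cong (_ ++_) (pairsOf-++ k ps qs)) (sym (++-assoc (nested (⟦ u ⟧ k) (⟦ g ⟧ k) (⟦ n ⟧ k)) _ _))
pairsOf-++ k (pair p d ∷ ps)   qs = cong (_ ∷_) (pairsOf-++ k ps qs)

-- (a , n) stands for the n terms of a progression starting at a
Block : Set
Block = Lin × Lin

positionBlocks : List Piece → List Block
positionBlocks []                = []
positionBlocks (nest u g n ∷ ps) = (u , n) ∷ (u ⊕ n ⊕ g , n) ∷ positionBlocks ps
positionBlocks (pair p d ∷ ps)   = (p , 0 k+ 1) ∷ (p ⊕ d , 0 k+ 1) ∷ positionBlocks ps

differenceBlocks : List Piece → List Block
differenceBlocks []                = []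
differenceBlocks (nest u g n ∷ ps) = (0 k+ 1 ⊕ g , n) ∷ differenceBlocks ps
differenceBlocks (pair p d ∷ ps)   = (d , 0 k+ 1) ∷ differenceBlocks ps

evalBlocks : ℕ → List Block → List (ℕ × ℕ)
evalBlocks k = map λ (a , n) → ⟦ a ⟧ k , ⟦ n ⟧ k

⋃ : ℕ → List (ℕ × ℕ) → List ℕ
⋃ c = concatMap λ (a , n) → progression c a n

⋃-resp-↭ : ∀ c {bs cs} → bs ↭ cs → ⋃ c bs ↭ ⋃ c cs
⋃-resp-↭ c refl = ↭-refl
⋃-resp-↭ c (prep (a , n) p) = ++⁺ˡ (progression c a n) (⋃-resp-↭ c p)
⋃-resp-↭ c (swap (a , n) (b , m) p) =
  ↭-trans (shifts (progression c a n) (progression c b m))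
          (++⁺ˡ (progression c b m) (++⁺ˡ (progression c a n) (⋃-resp-↭ c p)))
⋃-resp-↭ c (trans p q) = ↭-trans (⋃-resp-↭ c p) (⋃-resp-↭ c q)

positions-pairsOf : ∀ k ps → positions (pairsOf k ps) ↭ ⋃ 1 (evalBlocks k (positionBlocks ps))
positions-pairsOf k [] = ↭-refl
positions-pairsOf k (nest u g n ∷ ps)
  rewrite positions-++ (nested (⟦ u ⟧ k) (⟦ g ⟧ k) (⟦ n ⟧ k)) (pairsOf k ps)
        | ⟦⊕⟧ (u ⊕ n) g k | ⟦⊕⟧ u n k =
  ↭-trans (++⁺ (positions-nested (⟦ u ⟧ k) (⟦ g ⟧ k) (⟦ n ⟧ k)) (positions-pairsOf k ps))
          (↭-reflexive (++-assoc (range (⟦ u ⟧ k) (⟦ n ⟧ k)) _ _))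
positions-pairsOf k (pair p d ∷ ps) rewrite ⟦⊕⟧ p d k | *-zeroʳ k =
  prep _ (prep _ (positions-pairsOf k ps))

differences-pairsOf : ∀ k ps → differences (pairsOf k ps) ↭ ⋃ 2 (evalBlocks k (differenceBlocks ps))
differences-pairsOf k [] = ↭-refl
differences-pairsOf k (nest u g n ∷ ps)
  rewrite map-++ proj₂ (nested (⟦ u ⟧ k) (⟦ g ⟧ k) (⟦ n ⟧ k)) (pairsOf k ps)
        | ⟦⊕⟧ (0 k+ 1) g k | *-zeroʳ k =
  ++⁺ (differences-nested (⟦ u ⟧ k) (⟦ g ⟧ k) (⟦ n ⟧ k)) (differences-pairsOf k ps)
differences-pairsOf k (pair p d ∷ ps) rewrite *-zeroʳ k = prep _ (differences-pairsOf k ps)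

chain : ℕ → Lin → List Lin → List Block
chain c a []       = []
chain c a (n ∷ ns) = (a , n) ∷ chain c (a ⊕ c ⊛ n) ns

total : List Lin → Lin
total = foldr _⊕_ (0 k+ 0)

⋃-chain : ∀ c k a ns → ⋃ c (evalBlocks k (chain c a ns)) ≡ progression c (⟦ a ⟧ k) (⟦ total ns ⟧ k)
⋃-chain c k a [] rewrite *-zeroʳ k = refl
⋃-chain c k a (n ∷ ns) = begin
  progression c (⟦ a ⟧ k) (⟦ n ⟧ k) ++ ⋃ c (evalBlocks k (chain c (a ⊕ c ⊛ n) ns))
    ≡⟨ cong (progression c (⟦ a ⟧ k) (⟦ n ⟧ k) ++_) (⋃-chain c k (a ⊕ c ⊛ n) ns) ⟩
  progression c (⟦ a ⟧ k) (⟦ n ⟧ k) ++ progression c (⟦ a ⊕ c ⊛ n ⟧ k) (⟦ total ns ⟧ k)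
    ≡⟨ cong (λ x → progression c (⟦ a ⟧ k) (⟦ n ⟧ k) ++ progression c x (⟦ total ns ⟧ k)) frontier ⟩
  progression c (⟦ a ⟧ k) (⟦ n ⟧ k) ++ progression c (⟦ a ⟧ k + ⟦ n ⟧ k * c) (⟦ total ns ⟧ k)
    ≡⟨ progression-++ c (⟦ a ⟧ k) (⟦ n ⟧ k) (⟦ total ns ⟧ k) ⟩
  progression c (⟦ a ⟧ k) (⟦ n ⟧ k + ⟦ total ns ⟧ k)
    ≡⟨ cong (progression c (⟦ a ⟧ k)) (sym (⟦⊕⟧ n (total ns) k)) ⟩
  progression c (⟦ a ⟧ k) (⟦ n ⊕ total ns ⟧ k) ∎
  where
  open ≡-Reasoning
  frontier : ⟦ a ⊕ c ⊛ n ⟧ k ≡ ⟦ a ⟧ k + ⟦ n ⟧ k * c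
  frontier = ≡-trans (⟦⊕⟧ a (c ⊛ n) k) (cong (⟦ a ⟧ k +_) (⟦⊛⟧ c n k))

record Arrangement (c : ℕ) (a : Lin) (bs : List Block) : Set where
  constructor arrangement
  field
    lengths  : List Lin
    leftover : List Block
    arranged : bs ↭ chain c a lengths ++ leftover

open Arrangement

extract : (a : Lin) (bs : List Block) → Maybe (Σ[ n ∈ Lin ] Σ[ rest ∈ List Block ] bs ↭ (a , n) ∷ rest)
extract a []             = nothing
extract a ((b , n) ∷ bs) with b ≟ₗ a
... | yes refl = just (n , bs , ↭-refl)
... | no _     = Maybe.map (λ (m , rest , p) → m , (b , n) ∷ rest , ↭-trans (prep _ p) (swap _ _ ↭-refl))
                           (extract a bs)

-- Greedy search for a chain: the next block is any one starting at the current frontier.  Nothing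
-- depends on the search being complete; the certificates below only inspect its output.
arrange : (c fuel : ℕ) (a : Lin) (bs : List Block) → Arrangement c a bs
arrange c zero       a bs = arrangement [] bs ↭-refl
arrange c (suc fuel) a bs with extract a bs
... | nothing = arrangement [] bs ↭-refl
... | just (n , rest , bs↭) with arrange c fuel (a ⊕ c ⊛ n) rest
...   | arrangement ns rest′ rest↭ = arrangement (n ∷ ns) rest′ (↭-trans bs↭ (prep _ rest↭))

arrangement-sound : ∀ {c a bs} (A : Arrangement c a bs) k →
  ⋃ c (evalBlocks k bs) ↭ progression c (⟦ a ⟧ k) (⟦ total (lengths A) ⟧ k) ++ ⋃ c (evalBlocks k (leftover A))
arrangement-sound {c} {a} {bs} (arrangement ns rest bs↭) k = begin
  ⋃ c (evalBlocks k bs)                      ↭⟨ ⋃-resp-↭ c (map⁺ _ bs↭) ⟩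
  ⋃ c (evalBlocks k (chain c a ns ++ rest))  ≡⟨ cong (⋃ c) (map-++ _ (chain c a ns) rest) ⟩
  ⋃ c (evalBlocks k (chain c a ns) ++ evalBlocks k rest)  ≡⟨ concatMap-++ _ (evalBlocks k (chain c a ns)) _ ⟩
  ⋃ c (evalBlocks k (chain c a ns)) ++ ⋃ c (evalBlocks k rest)
    ≡⟨ cong (_++ ⋃ c (evalBlocks k rest)) (⋃-chain c k a ns) ⟩
  progression c (⟦ a ⟧ k) (⟦ total ns ⟧ k) ++ ⋃ c (evalBlocks k rest) ∎
  where open PermutationReasoning

arrangeBlocks : (c : ℕ) (a : Lin) (bs : List Block) → Arrangement c a bs
arrangeBlocks c a bs = arrange c (length bs) a bs

positionArrangement : (ps : List Piece) → Arrangement 1 (0 k+ 1) (positionBlocks ps)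
positionArrangement ps = arrangeBlocks 1 (0 k+ 1) (positionBlocks ps)

oddDifferences : (ps : List Piece) → Arrangement 2 (0 k+ 1) (differenceBlocks ps)
oddDifferences ps = arrangeBlocks 2 (0 k+ 1) (differenceBlocks ps)

evenDifferences : (ps : List Piece) → Arrangement 2 (0 k+ 2) (leftover (oddDifferences ps))
evenDifferences ps = arrangeBlocks 2 (0 k+ 2) (leftover (oddDifferences ps))

PositionsArranged : List Piece → Set
PositionsArranged ps = leftover (positionArrangement ps) ≡ []

HookedPositionsArranged : List Piece → Set
HookedPositionsArranged ps = leftover A ≡ [ (total (lengths A) ⊕ 0 k+ 2 , 0 k+ 1) ]
  where A = positionArrangement ps

-- The odd differences form one chain of step 2 from 1, the even ones another from 2.
DifferencesArranged : List Piece → Set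
DifferencesArranged ps = leftover (evenDifferences ps) ≡ [] × (odd ≡ even ⊎ odd ≡ even ⊕ 0 k+ 1)
  where
  odd  = total (lengths (oddDifferences ps))
  even = total (lengths (evenDifferences ps))

positions-arranged : ∀ k ps → positions (pairsOf k ps) ↭
  range 1 (⟦ total (lengths (positionArrangement ps)) ⟧ k) ++ ⋃ 1 (evalBlocks k (leftover (positionArrangement ps)))
positions-arranged k ps =
  subst (λ a → positions (pairsOf k ps) ↭ range a (⟦ total (lengths A) ⟧ k) ++ ⋃ 1 (evalBlocks k (leftover A)))
        (⟦const⟧ 1 k) (↭-trans (positions-pairsOf k ps) (arrangement-sound A k))
  where A = positionArrangement ps

differences-arranged : ∀ ps → DifferencesArranged ps → ∀ k →
  differences (pairsOf k ps) ↭ range 1 (length (pairsOf k ps))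
differences-arranged ps (done , balanced) k =
  subst (λ n → differences (pairsOf k ps) ↭ range 1 n) (length-map proj₂ (pairsOf k ps)) (↭-range-length (begin
    differences (pairsOf k ps)                              ↭⟨ differences-pairsOf k ps ⟩
    ⋃ 2 (evalBlocks k (differenceBlocks ps))                ↭⟨ arrangement-sound (oddDifferences ps) k ⟩
    progression 2 (⟦ 0 k+ 1 ⟧ k) odd ++ ⋃ 2 (evalBlocks k (leftover (oddDifferences ps)))
                                                            ↭⟨ ++⁺ˡ _ (arrangement-sound (evenDifferences ps) k) ⟩
    progression 2 (⟦ 0 k+ 1 ⟧ k) odd ++ (progression 2 (⟦ 0 k+ 2 ⟧ k) even ++ ⋃ 2 (evalBlocks k evenLeftover))
                                                            ≡⟨ cong₂ (λ a xs → progression 2 a odd ++ xs) (⟦const⟧ 1 k) tail ⟩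
    progression 2 1 odd ++ progression 2 2 even             ↭⟨ interleave 1 (evaluate balanced) ⟩
    range 1 (odd + even)                                    ∎))
  where
  open PermutationReasoning
  odd  = ⟦ total (lengths (oddDifferences ps)) ⟧ k
  even = ⟦ total (lengths (evenDifferences ps)) ⟧ k
  evenLeftover = leftover (evenDifferences ps)
  tail : progression 2 (⟦ 0 k+ 2 ⟧ k) even ++ ⋃ 2 (evalBlocks k evenLeftover) ≡ progression 2 2 even
  tail rewrite done | ⟦const⟧ 2 k = ++-identityʳ _
  evaluate : ∀ {x y} → x ≡ y ⊎ x ≡ y ⊕ 0 k+ 1 → ⟦ x ⟧ k ≡ ⟦ y ⟧ k ⊎ ⟦ x ⟧ k ≡ suc (⟦ y ⟧ k)
  evaluate {y = y} (inj₁ refl) = inj₁ refl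
  evaluate {y = y} (inj₂ refl) =
    inj₂ (≡-trans (⟦⊕⟧ y (0 k+ 1) k) (≡-trans (cong (⟦ y ⟧ k +_) (⟦const⟧ 1 k)) (+-comm _ 1)))

positions-covered : ∀ ps → PositionsArranged ps → ∀ k →
  positions (pairsOf k ps) ↭ range 1 (length (positions (pairsOf k ps)))
positions-covered ps done k = ↭-range-length (↭-trans (positions-arranged k ps)
  (↭-reflexive (≡-trans (cong (λ r → range 1 L ++ ⋃ 1 (evalBlocks k r)) done) (++-identityʳ (range 1 L)))))
  where L = ⟦ total (lengths (positionArrangement ps)) ⟧ k

⋃-hook : ∀ x k → ⋃ 1 (evalBlocks k [ (x ⊕ 0 k+ 2 , 0 k+ 1) ]) ≡ [ 2 + ⟦ x ⟧ k ]
⋃-hook x k rewrite ⟦⊕⟧ x (0 k+ 2) k | *-zeroʳ k | +-comm (⟦ x ⟧ k) 2 = refl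

skolem-from-pieces : ∀ ps → PositionsArranged ps → DifferencesArranged ps → ∀ k →
  IsSkolem (⟦ order ps ⟧ k) (pairsOf k ps)
skolem-from-pieces ps done dif k =
  length-pairsOf k ps ,
  subst (λ m → positions (pairsOf k ps) ↭ range 1 m)
        (≡-trans (length-positions (pairsOf k ps)) (cong₂ _+_ (length-pairsOf k ps) (length-pairsOf k ps)))
        (positions-covered ps done k) ,
  subst (λ m → differences (pairsOf k ps) ↭ range 1 m) (length-pairsOf k ps) (differences-arranged ps dif k)

hookedSkolem-from-pieces : ∀ ps → HookedPositionsArranged ps → DifferencesArranged ps → ∀ k →
  IsHookedSkolem (⟦ order ps ⟧ k) (pairsOf k ps)
hookedSkolem-from-pieces ps hooked dif k =
  length-pairsOf k ps ,
  subst (λ m → positions (pairsOf k ps) ↭ range 1 (m ∸ 1) ++ [ suc m ])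
        (≡-trans (length-positions (pairsOf k ps)) (cong₂ _+_ (length-pairsOf k ps) (length-pairsOf k ps)))
        (↭-hooked-length (↭-trans (positions-arranged k ps)
          (↭-reflexive (cong (range 1 (⟦ L ⟧ k) ++_)
            (≡-trans (cong (λ r → ⋃ 1 (evalBlocks k r)) hooked) (⋃-hook L k)))))) ,
  subst (λ m → differences (pairsOf k ps) ↭ range 1 m) (length-pairsOf k ps) (differences-arranged ps dif k)
  where L = total (lengths (positionArrangement ps))

twinNested : (start₁ start₂ gap count : ℕ) → List (ℕ × ℕ × ℕ)
twinNested u v g zero    = []
twinNested u v g (suc n) = (suc g + n * 2 , u , v) ∷ twinNested (suc u) (suc v) g n

data TwinPiece : Set where
  twinNest : (start₁ start₂ gap count : Lin) → TwinPiece
  twinPair : (difference position₁ position₂ : Lin) → TwinPiece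

triplesOf : ℕ → List TwinPiece → List (ℕ × ℕ × ℕ)
triplesOf k []                      = []
triplesOf k (twinNest u v g n ∷ qs) = twinNested (⟦ u ⟧ k) (⟦ v ⟧ k) (⟦ g ⟧ k) (⟦ n ⟧ k) ++ triplesOf k qs
triplesOf k (twinPair d p q ∷ qs)   = (⟦ d ⟧ k , ⟦ p ⟧ k , ⟦ q ⟧ k) ∷ triplesOf k qs

firstCopies secondCopies : List TwinPiece → List Piece
firstCopies []                       = []
firstCopies (twinNest u v g n ∷ qs)  = nest u g n ∷ firstCopies qs
firstCopies (twinPair d p q ∷ qs)    = pair p d ∷ firstCopies qs
secondCopies []                      = []
secondCopies (twinNest u v g n ∷ qs) = nest v g n ∷ secondCopies qs
secondCopies (twinPair d p q ∷ qs)   = pair q d ∷ secondCopies qs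

firsts-twinNested : ∀ u v g n → firsts (twinNested u v g n) ≡ nested u g n
firsts-twinNested u v g zero    = refl
firsts-twinNested u v g (suc n) = cong (_ ∷_) (firsts-twinNested (suc u) (suc v) g n)

seconds-twinNested : ∀ u v g n → seconds (twinNested u v g n) ≡ nested v g n
seconds-twinNested u v g zero    = refl
seconds-twinNested u v g (suc n) = cong (_ ∷_) (seconds-twinNested (suc u) (suc v) g n)

firsts-triplesOf : ∀ k qs → firsts (triplesOf k qs) ≡ pairsOf k (firstCopies qs)
firsts-triplesOf k [] = refl
firsts-triplesOf k (twinNest u v g n ∷ qs) =
  ≡-trans (map-++ _ (twinNested (⟦ u ⟧ k) (⟦ v ⟧ k) (⟦ g ⟧ k) (⟦ n ⟧ k)) (triplesOf k qs))
          (cong₂ _++_ (firsts-twinNested (⟦ u ⟧ k) (⟦ v ⟧ k) (⟦ g ⟧ k) (⟦ n ⟧ k)) (firsts-triplesOf k qs))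
firsts-triplesOf k (twinPair d p q ∷ qs) = cong (_ ∷_) (firsts-triplesOf k qs)

seconds-triplesOf : ∀ k qs → seconds (triplesOf k qs) ≡ pairsOf k (secondCopies qs)
seconds-triplesOf k [] = refl
seconds-triplesOf k (twinNest u v g n ∷ qs) =
  ≡-trans (map-++ _ (twinNested (⟦ u ⟧ k) (⟦ v ⟧ k) (⟦ g ⟧ k) (⟦ n ⟧ k)) (triplesOf k qs))
          (cong₂ _++_ (seconds-twinNested (⟦ u ⟧ k) (⟦ v ⟧ k) (⟦ g ⟧ k) (⟦ n ⟧ k)) (seconds-triplesOf k qs))
seconds-triplesOf k (twinPair d p q ∷ qs) = cong (_ ∷_) (seconds-triplesOf k qs)

twoFoldSkolem-from-pieces : ∀ qs → PositionsArranged (firstCopies qs ++ secondCopies qs) →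
  DifferencesArranged (firstCopies qs) → ∀ k → IsTwoFoldSkolem (⟦ order (firstCopies qs) ⟧ k) (triplesOf k qs)
twoFoldSkolem-from-pieces qs done dif k =
  length≡ ,
  subst (λ m → P ↭ range 1 m) (≡-trans length-P (cong (4 *_) length≡))
        (subst (λ xs → xs ↭ range 1 (length xs)) (sym P≡) (positions-covered (F ++ S) done k)) ,
  subst (λ xs → xs ↭ range 1 (⟦ order F ⟧ k))
        (≡-trans (cong differences (sym (firsts-triplesOf k qs))) (sym (map-∘ Q)))
        (subst (λ m → differences (pairsOf k F) ↭ range 1 m) (length-pairsOf k F) (differences-arranged F dif k))
  where
  F = firstCopies qs
  S = secondCopies qs
  Q = triplesOf k qs
  P = positions (firsts Q) ++ positions (seconds Q)
  length≡ : length Q ≡ ⟦ order F ⟧ k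
  length≡ = ≡-trans (sym (length-map _ Q)) (≡-trans (cong length (firsts-triplesOf k qs)) (length-pairsOf k F))
  P≡ : P ≡ positions (pairsOf k (F ++ S))
  P≡ rewrite firsts-triplesOf k qs | seconds-triplesOf k qs | pairsOf-++ k F S =
    sym (positions-++ (pairsOf k F) (pairsOf k S))
  quadruple : ∀ m → m + m + (m + m) ≡ 4 * m
  quadruple = solve-∀
  length-P : length P ≡ 4 * length Q
  length-P rewrite length-++ (positions (firsts Q)) {positions (seconds Q)}
                 | length-positions (firsts Q) | length-positions (seconds Q)
                 | length-map (λ ((d , p , q) : ℕ × ℕ × ℕ) → p , d) Q
                 | length-map (λ ((d , p , q) : ℕ × ℕ × ℕ) → q , d) Q = quadruple (length Q)

-- Existence of Skolem systems

skolemPieces-4k+8 skolemPieces-4k+9 hookedPieces-4k+10 hookedPieces-4k+7 : List Piece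
skolemPieces-4k+8 =
  nest (4 k+ 8) (0 k+ 1) (2 k+ 4) ∷ nest (0 k+ 1) (2 k+ 6) (1 k+ 0) ∷ nest (1 k+ 4) (0 k+ 2) (1 k+ 0) ∷
  pair (1 k+ 1) (2 k+ 5) ∷ pair (1 k+ 2) (0 k+ 1) ∷ pair (2 k+ 4) (2 k+ 3) ∷ pair (2 k+ 5) (4 k+ 7) ∷ []
skolemPieces-4k+9 =
  nest (4 k+ 10) (0 k+ 1) (2 k+ 4) ∷ pair (2 k+ 5) (4 k+ 9) ∷ nest (0 k+ 2) (2 k+ 4) (1 k+ 2) ∷
  pair (0 k+ 1) (2 k+ 3) ∷ nest (1 k+ 4) (0 k+ 2) (1 k+ 0) ∷ pair (3 k+ 6) (0 k+ 1) ∷ []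
hookedPieces-4k+10 =
  nest (0 k+ 1) (0 k+ 1) (2 k+ 5) ∷ pair (2 k+ 6) (4 k+ 9) ∷ nest (4 k+ 12) (2 k+ 8) (1 k+ 0) ∷
  nest (5 k+ 12) (0 k+ 2) (1 k+ 2) ∷ pair (6 k+ 14) (2 k+ 7) ∷ pair (7 k+ 18) (0 k+ 1) ∷ []
hookedPieces-4k+7 =
  nest (0 k+ 1) (0 k+ 1) (2 k+ 3) ∷ pair (2 k+ 4) (4 k+ 7) ∷ nest (4 k+ 8) (2 k+ 4) (1 k+ 1) ∷
  pair (5 k+ 9) (0 k+ 1) ∷ nest (5 k+ 11) (0 k+ 2) (1 k+ 0) ∷ pair (6 k+ 12) (2 k+ 3) ∷ []

skolem-4k+8 : ∀ k → IsSkolem (8 + k * 4) (pairsOf k skolemPieces-4k+8)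
skolem-4k+8 = skolem-from-pieces skolemPieces-4k+8 refl (refl , inj₁ refl)

skolem-4k+9 : ∀ k → IsSkolem (9 + k * 4) (pairsOf k skolemPieces-4k+9)
skolem-4k+9 = skolem-from-pieces skolemPieces-4k+9 refl (refl , inj₂ refl)

hookedSkolem-4k+10 : ∀ k → IsHookedSkolem (10 + k * 4) (pairsOf k hookedPieces-4k+10)
hookedSkolem-4k+10 = hookedSkolem-from-pieces hookedPieces-4k+10 refl (refl , inj₁ refl)

hookedSkolem-4k+7 : ∀ k → IsHookedSkolem (7 + k * 4) (pairsOf k hookedPieces-4k+7)
hookedSkolem-4k+7 = hookedSkolem-from-pieces hookedPieces-4k+7 refl (refl , inj₂ refl)

fixedPairs : List (ℕ × ℕ) → List Piece
fixedPairs = map λ (p , d) → pair (0 k+ p) (0 k+ d)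

skolem₁ : IsSkolem 1 ((1 , 1) ∷ [])
skolem₁ = skolem-from-pieces (fixedPairs ((1 , 1) ∷ [])) refl (refl , inj₂ refl) 0

skolem₄ : IsSkolem 4 ((1 , 4) ∷ (3 , 3) ∷ (2 , 2) ∷ (7 , 1) ∷ [])
skolem₄ = skolem-from-pieces (fixedPairs ((1 , 4) ∷ (3 , 3) ∷ (2 , 2) ∷ (7 , 1) ∷ [])) refl (refl , inj₁ refl) 0

skolem₅ : IsSkolem 5 ((1 , 5) ∷ (3 , 4) ∷ (5 , 3) ∷ (2 , 2) ∷ (9 , 1) ∷ [])
skolem₅ =
  skolem-from-pieces (fixedPairs ((1 , 5) ∷ (3 , 4) ∷ (5 , 3) ∷ (2 , 2) ∷ (9 , 1) ∷ [])) refl (refl , inj₂ refl) 0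

hookedSkolem₂ : IsHookedSkolem 2 ((3 , 2) ∷ (1 , 1) ∷ [])
hookedSkolem₂ = hookedSkolem-from-pieces (fixedPairs ((3 , 2) ∷ (1 , 1) ∷ [])) refl (refl , inj₁ refl) 0

hookedSkolem₃ : IsHookedSkolem 3 ((1 , 3) ∷ (5 , 2) ∷ (2 , 1) ∷ [])
hookedSkolem₃ = hookedSkolem-from-pieces (fixedPairs ((1 , 3) ∷ (5 , 2) ∷ (2 , 1) ∷ [])) refl (refl , inj₂ refl) 0

hookedSkolem₆ : IsHookedSkolem 6 ((1 , 6) ∷ (3 , 5) ∷ (2 , 4) ∷ (10 , 3) ∷ (9 , 2) ∷ (4 , 1) ∷ [])
hookedSkolem₆ =
  hookedSkolem-from-pieces (fixedPairs ((1 , 6) ∷ (3 , 5) ∷ (2 , 4) ∷ (10 , 3) ∷ (9 , 2) ∷ (4 , 1) ∷ []))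
    refl (refl , inj₁ refl) 0

twoFoldPieces-2e+1 twoFoldPieces-2e+2 : List TwinPiece
twoFoldPieces-2e+1 =
  twinPair (2 k+ 1) (4 k+ 3) (1 k+ 1) ∷ twinNest (4 k+ 4) (6 k+ 5) (0 k+ 0) (1 k+ 0) ∷
  twinNest (0 k+ 1) (2 k+ 2) (0 k+ 1) (1 k+ 0) ∷ []
twoFoldPieces-2e+2 =
  twinPair (2 k+ 2) (0 k+ 1) (1 k+ 2) ∷ twinNest (0 k+ 2) (2 k+ 4) (0 k+ 1) (1 k+ 0) ∷
  twinNest (4 k+ 5) (6 k+ 7) (0 k+ 0) (1 k+ 1) ∷ []

twoFoldSkolem-2e+1 : ∀ e → IsTwoFoldSkolem (1 + e * 2) (triplesOf e twoFoldPieces-2e+1)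
twoFoldSkolem-2e+1 = twoFoldSkolem-from-pieces twoFoldPieces-2e+1 refl (refl , inj₂ refl)

twoFoldSkolem-2e+2 : ∀ e → IsTwoFoldSkolem (2 + e * 2) (triplesOf e twoFoldPieces-2e+2)
twoFoldSkolem-2e+2 = twoFoldSkolem-from-pieces twoFoldPieces-2e+2 refl (refl , inj₁ refl)

elim-mod : ∀ {t r} n .{{_ : NonZero n}} (P : ℕ → Set) → t % n ≡ r → (∀ q → P (r + q * n)) → P t
elim-mod {t} n P t%n≡r f = subst P (sym (≡-trans (m≡m%n+[m/n]*n t n) (cong (_+ t / n * n) t%n≡r))) (f (t / n))

skolem-exists : ∀ t → 1 ≤ t → t % 4 ≡ 0 ⊎ t % 4 ≡ 1 → ∃ (IsSkolem t)
skolem-exists t 1≤t (inj₁ t%4≡0) = elim-mod 4 (λ t → 1 ≤ t → ∃ (IsSkolem t)) t%4≡0 (λ where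
  0             ()
  1             _ → -, skolem₄
  (suc (suc k)) _ → -, skolem-4k+8 k) 1≤t
skolem-exists t _ (inj₂ t%4≡1) = elim-mod 4 (∃ ∘ IsSkolem) t%4≡1 λ where
  0             → -, skolem₁
  1             → -, skolem₅
  (suc (suc k)) → -, skolem-4k+9 k

hookedSkolem-exists : ∀ t → t % 4 ≡ 2 ⊎ t % 4 ≡ 3 → ∃ (IsHookedSkolem t)
hookedSkolem-exists t (inj₁ t%4≡2) = elim-mod 4 (∃ ∘ IsHookedSkolem) t%4≡2 λ where
  0             → -, hookedSkolem₂
  1             → -, hookedSkolem₆
  (suc (suc k)) → -, hookedSkolem-4k+10 k
hookedSkolem-exists t (inj₂ t%4≡3) = elim-mod 4 (∃ ∘ IsHookedSkolem) t%4≡3 λ where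
  0       → -, hookedSkolem₃
  (suc k) → -, hookedSkolem-4k+7 k

twoFoldSkolem-exists : ∀ s → ∃ (IsTwoFoldSkolem s)
twoFoldSkolem-exists s with s % 2 in s%2 | m%n<n s 2
... | 0 | _ = elim-mod 2 (∃ ∘ IsTwoFoldSkolem) s%2 λ where
  0       → [] , refl , ↭-refl , ↭-refl
  (suc e) → -, twoFoldSkolem-2e+2 e
... | 1 | _ = elim-mod 2 (∃ ∘ IsTwoFoldSkolem) s%2 λ e → -, twoFoldSkolem-2e+1 e
... | suc (suc _) | s≤s (s≤s ())

-- The labelling of the windmill

module WindmillLabelling (T : List (ℕ × ℕ)) (Q : List (ℕ × ℕ × ℕ)) where

  t s offset : ℕ
  t      = length T
  s      = length Q
  offset = t + 4 * s

  G : Graph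
  G = C3C4 t s

  triangleLabel : ℕ × ℕ → Fin 2 → ℕ
  triangleLabel (p , d) 0F = offset + p
  triangleLabel (p , d) 1F = offset + (p + d)

  squareLabel : ℕ × ℕ × ℕ → Fin 3 → ℕ
  squareLabel (d , p , q) 0F = d + (t + p)
  squareLabel (d , p , q) 1F = d
  squareLabel (d , p , q) 2F = d + (t + q)

  label : WVert t s → ℕ
  label centre    = 0
  label (tri i x) = triangleLabel (lookup T i) x
  label (sq j x)  = squareLabel (lookup Q j) x

  edgeLabel : WVert t s × WVert t s → ℕ
  edgeLabel (u , v) = ∣ label u - label v ∣

  E : List ℕ
  E = edgeLabels G label

  triangleEdgeLabels : ℕ × ℕ → List ℕ
  triangleEdgeLabels (p , d) = offset + p ∷ d ∷ offset + (p + d) ∷ []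

  squareEdgeLabels : ℕ × ℕ × ℕ → List ℕ
  squareEdgeLabels (d , p , q) = d + (t + p) ∷ t + p ∷ t + q ∷ d + (t + q) ∷ []

  triEdges-labels : ∀ i → map edgeLabel (triEdges i) ≡ triangleEdgeLabels (lookup T i)
  triEdges-labels i = cong₂ (λ x y → offset + p ∷ x ∷ y ∷ [])
    (≡-trans (∣m+n-m+o∣≡∣n-o∣ offset p (p + d)) (∣m-m+n∣≡n p d)) (∣-∣-identityʳ (offset + (p + d)))
    where
    p = proj₁ (lookup T i)
    d = proj₂ (lookup T i)

  sqEdges-labels : ∀ j → map edgeLabel (sqEdges j) ≡ squareEdgeLabels (lookup Q j)
  sqEdges-labels j =
    cong (d + (t + p) ∷_) (cong₂ _∷_ (≡-trans (∣-∣-comm (d + (t + p)) d) (∣m-m+n∣≡n d (t + p)))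
                         (cong₂ _∷_ (∣m-m+n∣≡n d (t + q)) (cong [_] (∣-∣-identityʳ (d + (t + q))))))
    where
    d = proj₁ (lookup Q j)
    p = proj₁ (proj₂ (lookup Q j))
    q = proj₂ (proj₂ (lookup Q j))

  edgeLabels-windmill : E ≡ concatMap triangleEdgeLabels T ++ concatMap squareEdgeLabels Q
  edgeLabels-windmill = ≡-trans (map-++ edgeLabel (concatMap triEdges (allFin t)) _)
    (cong₂ _++_ (vanes T triEdges triangleEdgeLabels triEdges-labels) (vanes Q sqEdges squareEdgeLabels sqEdges-labels))
    where
    vanes : ∀ {A : Set} (xs : List A) (es : Fin (length xs) → List (WVert t s × WVert t s)) (ls : A → List ℕ) →
            (∀ i → map edgeLabel (es i) ≡ ls (lookup xs i)) →
            map edgeLabel (concatMap es (allFin (length xs))) ≡ concatMap ls xs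
    vanes xs es ls es≗ls = ≡-trans (map-concatMap edgeLabel es (allFin (length xs)))
      (≡-trans (concatMap-cong es≗ls (allFin (length xs))) (concatMap-lookup ls xs))

  triangleEdgeLabels-↭ : ∀ T′ → concatMap triangleEdgeLabels T′ ↭ differences T′ ++ map (offset +_) (positions T′)
  triangleEdgeLabels-↭ []            = ↭-refl
  triangleEdgeLabels-↭ ((p , d) ∷ T′) =
    ↭-trans (swap (offset + p) d (prep (offset + (p + d)) (triangleEdgeLabels-↭ T′)))
            (prep d (shifts (offset + p ∷ offset + (p + d) ∷ []) (differences T′)))

  squareEdgeLabels-↭ : ∀ Q′ →
    concatMap squareEdgeLabels Q′ ↭ map (t +_) (positions (firsts Q′)) ++ map (t +_) (positions (seconds Q′))
  squareEdgeLabels-↭ [] = ↭-refl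
  squareEdgeLabels-↭ ((d , p , q) ∷ Q′) = begin
    d + (t + p) ∷ t + p ∷ t + q ∷ d + (t + q) ∷ concatMap squareEdgeLabels Q′
      ↭⟨ swap _ _ (prep _ (prep _ (squareEdgeLabels-↭ Q′))) ⟩
    t + p ∷ d + (t + p) ∷ t + q ∷ d + (t + q) ∷ (F ++ S)
      ≡⟨ cong₂ (λ x y → t + p ∷ x ∷ t + q ∷ y ∷ (F ++ S)) (reorder d t p) (reorder d t q) ⟩
    t + p ∷ t + (p + d) ∷ t + q ∷ t + (q + d) ∷ (F ++ S)
      ↭⟨ prep _ (prep _ (shifts (t + q ∷ t + (q + d) ∷ []) F)) ⟩
    t + p ∷ t + (p + d) ∷ (F ++ t + q ∷ t + (q + d) ∷ S) ∎
    where
    open PermutationReasoning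
    F = map (t +_) (positions (firsts Q′))
    S = map (t +_) (positions (seconds Q′))
    reorder : ∀ d t x → d + (t + x) ≡ t + (x + d)
    reorder = solve-∀

  edgeLabels-↭ : differences T ↭ range 1 t → IsTwoFoldSkolem s Q → E ↭ range 1 offset ++ map (offset +_) (positions T)
  edgeLabels-↭ dT (_ , pQ , _) = begin
    E                                                      ≡⟨ edgeLabels-windmill ⟩
    concatMap triangleEdgeLabels T ++ concatMap squareEdgeLabels Q
      ↭⟨ ++⁺ (triangleEdgeLabels-↭ T) (squareEdgeLabels-↭ Q) ⟩
    (differences T ++ M) ++ (map (t +_) P₁ ++ map (t +_) P₂)  ≡⟨ ++-assoc (differences T) M _ ⟩
    differences T ++ (M ++ (map (t +_) P₁ ++ map (t +_) P₂))   ↭⟨ ++⁺ dT (++-comm M _) ⟩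
    range 1 t ++ ((map (t +_) P₁ ++ map (t +_) P₂) ++ M)
      ≡⟨ cong (λ xs → range 1 t ++ (xs ++ M)) (sym (map-++ (t +_) P₁ P₂)) ⟩
    range 1 t ++ (map (t +_) (P₁ ++ P₂) ++ M)
      ↭⟨ ++⁺ˡ (range 1 t) (++⁺ʳ M (map⁺ (t +_) pQ)) ⟩
    range 1 t ++ (map (t +_) (range 1 (4 * s)) ++ M)         ≡⟨ sym (++-assoc (range 1 t) _ M) ⟩
    (range 1 t ++ map (t +_) (range 1 (4 * s))) ++ M         ≡⟨ cong (_++ M) (range-++-map-+ t (4 * s)) ⟩
    range 1 offset ++ M                                      ∎
    where
    open PermutationReasoning
    M  = map (offset +_) (positions T)
    P₁ = positions (firsts Q)
    P₂ = positions (seconds Q)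

  length-E : length E ≡ size G
  length-E = length-map edgeLabel (edges G)

  edgeLabels-graceful : positions T ↭ range 1 (t + t) → differences T ↭ range 1 t → IsTwoFoldSkolem s Q →
    E ↭ oneTo (size G)
  edgeLabels-graceful pT dT Q₂ =
    subst (E ↭_) (sym (≡-trans (oneTo≡range (size G)) (cong (range 1) (sym length-E))))
      (↭-range-length (↭-trans (edgeLabels-↭ dT Q₂)
        (↭-trans (++⁺ˡ (range 1 offset) (map⁺ (offset +_) pT)) (↭-reflexive (range-++-map-+ offset (t + t))))))

  edgeLabels-nearGraceful : 1 ≤ t → positions T ↭ range 1 (t + t ∸ 1) ++ [ suc (t + t) ] →
    differences T ↭ range 1 t → IsTwoFoldSkolem s Q → E ↭ oneTo (size G ∸ 1) ++ [ suc (size G) ]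
  edgeLabels-nearGraceful 1≤t pT dT Q₂ =
    subst (λ m → E ↭ oneTo (m ∸ 1) ++ [ suc m ]) length-E
      (subst (λ xs → E ↭ xs ++ [ suc (length E) ]) (sym (oneTo≡range _)) (↭-hooked-length (begin
        E                                                                ↭⟨ edgeLabels-↭ dT Q₂ ⟩
        range 1 offset ++ map (offset +_) (positions T)                  ↭⟨ ++⁺ˡ (range 1 offset) (map⁺ (offset +_) pT) ⟩
        range 1 offset ++ map (offset +_) (range 1 L ++ [ suc (t + t) ])
          ≡⟨ cong (range 1 offset ++_) (map-++ (offset +_) (range 1 L) _) ⟩
        range 1 offset ++ (map (offset +_) (range 1 L) ++ [ offset + suc (t + t) ])
          ≡⟨ sym (++-assoc (range 1 offset) _ _) ⟩
        (range 1 offset ++ map (offset +_) (range 1 L)) ++ [ offset + suc (t + t) ]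
          ≡⟨ cong₂ (λ xs x → xs ++ [ x ]) (range-++-map-+ offset L) (hook-shift offset 1≤t) ⟩
        range 1 (offset + L) ++ [ 2 + (offset + L) ]                      ∎)))
    where
    open PermutationReasoning
    L = t + t ∸ 1

  data Spoke : WVert t s → Set where
    tri₀ : ∀ i → Spoke (tri i 0F)
    tri₁ : ∀ i → Spoke (tri i 1F)
    sq₀  : ∀ j → Spoke (sq j 0F)
    sq₂  : ∀ j → Spoke (sq j 2F)

  spokeEdge : ∀ {v} → Spoke v → WVert t s × WVert t s
  spokeEdge (tri₀ i) = centre , tri i 0F
  spokeEdge (tri₁ i) = tri i 1F , centre
  spokeEdge (sq₀ j)  = centre , sq j 0F
  spokeEdge (sq₂ j)  = sq j 2F , centre

  spokeEdge-∈ : ∀ {v} (σ : Spoke v) → spokeEdge σ ∈ edges G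
  spokeEdge-∈ (tri₀ i) = ∈-++⁺ˡ (∈-concat⁺′ (here refl) (∈-map⁺ triEdges (∈-allFin i)))
  spokeEdge-∈ (tri₁ i) = ∈-++⁺ˡ (∈-concat⁺′ (there (there (here refl))) (∈-map⁺ triEdges (∈-allFin i)))
  spokeEdge-∈ (sq₀ j)  = ∈-++⁺ʳ _ (∈-concat⁺′ (here refl) (∈-map⁺ sqEdges (∈-allFin j)))
  spokeEdge-∈ (sq₂ j)  = ∈-++⁺ʳ _ (∈-concat⁺′ (there (there (there (here refl)))) (∈-map⁺ sqEdges (∈-allFin j)))

  spokeEdge-label : ∀ {v} (σ : Spoke v) → edgeLabel (spokeEdge σ) ≡ label v
  spokeEdge-label (tri₀ i) = refl
  spokeEdge-label (tri₁ i) = ∣-∣-identityʳ _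
  spokeEdge-label (sq₀ j)  = refl
  spokeEdge-label (sq₂ j)  = ∣-∣-identityʳ _

  farEnd : WVert t s × WVert t s → WVert t s
  farEnd (centre , v) = v
  farEnd (u , _)      = u

  farEnd-spokeEdge : ∀ {v} (σ : Spoke v) → farEnd (spokeEdge σ) ≡ v
  farEnd-spokeEdge (tri₀ i) = refl
  farEnd-spokeEdge (tri₁ i) = refl
  farEnd-spokeEdge (sq₀ j)  = refl
  farEnd-spokeEdge (sq₂ j)  = refl

  spokeLabel-∈ : ∀ {v} → Spoke v → label v ∈ E
  spokeLabel-∈ σ = subst (_∈ E) (spokeEdge-label σ) (∈-map⁺ edgeLabel (spokeEdge-∈ σ))

  data Kind : WVert t s → Set where
    hub    : Kind centre
    spoke  : ∀ {v} → Spoke v → Kind v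
    middle : ∀ j → Kind (sq j 1F)

  kind : ∀ v → Kind v
  kind centre     = hub
  kind (tri i 0F) = spoke (tri₀ i)
  kind (tri i 1F) = spoke (tri₁ i)
  kind (sq j 0F)  = spoke (sq₀ j)
  kind (sq j 1F)  = middle j
  kind (sq j 2F)  = spoke (sq₂ j)

  label-bounded : ∀ {B} → (∀ {x} → x ∈ E → x ≤ B) → ∀ v → label v ≤ B
  label-bounded E≤B v with kind v
  ... | hub      = z≤n
  ... | spoke σ  = E≤B (spokeLabel-∈ σ)
  ... | middle j = ≤-trans (m≤m+n _ _) (E≤B (spokeLabel-∈ (sq₀ j)))

  module _ (1≤s : 1 ≤ s) (s≤t : s ≤ t) (dQ : map proj₁ Q ↭ range 1 s) where

    difference-bounds : ∀ j → 1 ≤ proj₁ (lookup Q j) × proj₁ (lookup Q j) ≤ t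
    difference-bounds j with ∈-range⁻ 1 s (∈-resp-↭ dQ (∈-map⁺ proj₁ (∈-lookup j)))
    ... | 1≤d , d<1+s = 1≤d , ≤-trans (≤-pred d<1+s) s≤t

    t<offset : t < offset
    t<offset = m<m+n t (≤-trans 1≤s (m≤m+n s (3 * s)))

    t<spokeLabel : ∀ {v} → Spoke v → t < label v
    t<spokeLabel (tri₀ i) = ≤-trans t<offset (m≤m+n offset _)
    t<spokeLabel (tri₁ i) = ≤-trans t<offset (m≤m+n offset _)
    t<spokeLabel (sq₀ j)  = ≤-trans (s≤s (m≤m+n t _)) (+-monoˡ-≤ _ (proj₁ (difference-bounds j)))
    t<spokeLabel (sq₂ j)  = ≤-trans (s≤s (m≤m+n t _)) (+-monoˡ-≤ _ (proj₁ (difference-bounds j)))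

    middleLabel<spokeLabel : ∀ {v} j → Spoke v → label (sq j 1F) < label v
    middleLabel<spokeLabel j σ = ≤-<-trans (proj₂ (difference-bounds j)) (t<spokeLabel σ)

    differences-unique : Unique (map (proj₁ ∘ lookup Q) (allFin s))
    differences-unique = subst Unique (sym (≡-trans (map-∘ (allFin s)) (cong (map proj₁) (map-lookup-allFin Q))))
                               (Unique-resp-↭ dQ (range-unique 1 s))

    label-injective : Unique E → Injective _≡_ _≡_ label
    label-injective uE {u} {v} eq with kind u | kind v
    ... | hub      | hub       = refl
    ... | hub      | spoke τ   = ⊥-elim (<⇒≢ (≤-<-trans z≤n (t<spokeLabel τ)) eq)
    ... | hub      | middle j  = ⊥-elim (<⇒≢ (proj₁ (difference-bounds j)) eq)
    ... | spoke σ  | hub       = ⊥-elim (<⇒≢ (≤-<-trans z≤n (t<spokeLabel σ)) (sym eq))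
    ... | middle j | hub       = ⊥-elim (<⇒≢ (proj₁ (difference-bounds j)) (sym eq))
    ... | spoke σ  | middle j  = ⊥-elim (<⇒≢ (middleLabel<spokeLabel j σ) (sym eq))
    ... | middle j | spoke τ   = ⊥-elim (<⇒≢ (middleLabel<spokeLabel j τ) eq)
    ... | middle j | middle j′ =
      cong (λ i → sq i 1F) (Unique[map]⇒injective (proj₁ ∘ lookup Q) differences-unique (∈-allFin j) (∈-allFin j′) eq)
    ... | spoke σ  | spoke τ   = begin
      u                  ≡⟨ farEnd-spokeEdge σ ⟨
      farEnd (spokeEdge σ) ≡⟨ cong farEnd (Unique[map]⇒injective edgeLabel uE (spokeEdge-∈ σ) (spokeEdge-∈ τ) labels≡) ⟩
      farEnd (spokeEdge τ) ≡⟨ farEnd-spokeEdge τ ⟩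
      v                  ∎
      where
      open ≡-Reasoning
      labels≡ : edgeLabel (spokeEdge σ) ≡ edgeLabel (spokeEdge τ)
      labels≡ = ≡-trans (spokeEdge-label σ) (≡-trans eq (sym (spokeEdge-label τ)))

  isGracefulLabelling : 1 ≤ s → s ≤ t → positions T ↭ range 1 (t + t) → differences T ↭ range 1 t →
    IsTwoFoldSkolem s Q → IsGracefulLabelling G label
  isGracefulLabelling 1≤s s≤t pT dT Q₂@(_ , _ , dQ) =
    label-injective 1≤s s≤t dQ (Unique-resp-↭ E↭ (oneTo-unique (size G))) ,
    label-bounded (∈-oneTo⁻ (size G) ∘ ∈-resp-↭ E↭) ,
    E↭
    where E↭ = edgeLabels-graceful pT dT Q₂

  isNearGracefulLabelling : 1 ≤ s → s ≤ t → positions T ↭ range 1 (t + t ∸ 1) ++ [ suc (t + t) ] →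
    differences T ↭ range 1 t → IsTwoFoldSkolem s Q → IsNearGracefulLabelling G label
  isNearGracefulLabelling 1≤s s≤t pT dT Q₂@(_ , _ , dQ) =
    label-injective 1≤s s≤t dQ (Unique-resp-↭ E↭ (hooked-unique (size G))) ,
    label-bounded (∈-hooked⁻ (size G) ∘ ∈-resp-↭ E↭) ,
    inj₂ E↭
    where E↭ = edgeLabels-nearGraceful (≤-trans 1≤s s≤t) pT dT Q₂

windmill-graceful : ∀ {t s} → 1 ≤ s → s ≤ t → ∃ (IsSkolem t) → ∃ (IsTwoFoldSkolem s) → Graceful (C3C4 t s)
windmill-graceful 1≤s s≤t (T , refl , pT , dT) (Q , Q₂@(refl , _)) = label , isGracefulLabelling 1≤s s≤t pT dT Q₂
  where open WindmillLabelling T Q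

windmill-nearGraceful : ∀ {t s} → 1 ≤ s → s ≤ t → ∃ (IsHookedSkolem t) → ∃ (IsTwoFoldSkolem s) →
  NearGraceful (C3C4 t s)
windmill-nearGraceful 1≤s s≤t (T , refl , pT , dT) (Q , Q₂@(refl , _)) =
  label , isNearGracefulLabelling 1≤s s≤t pT dT Q₂
  where open WindmillLabelling T Q

theorem4p1 : (t s : ℕ) → 1 ≤ s → s ≤ t →
    ((t % 4 ≡ 0 ⊎ t % 4 ≡ 1) → Graceful (C3C4 t s))
    × ((t % 4 ≡ 2 ⊎ t % 4 ≡ 3) → NearGraceful (C3C4 t s))
theorem4p1 t s 1≤s s≤t =
  (λ t%4 → windmill-graceful 1≤s s≤t (skolem-exists t (≤-trans 1≤s s≤t) t%4) (twoFoldSkolem-exists s)) ,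
  (λ t%4 → windmill-nearGraceful 1≤s s≤t (hookedSkolem-exists t t%4) (twoFoldSkolem-exists s))
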